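{- Let $k\in\mathbb{Z}_{\geq 0}$. For every positive integer solution $(x,y,z)=(a,b,c)$ of \[x^2+y^4+z^4+ky^2z^2+2xy^2+2xz^2=(7+k)xy^2z^2,\] the numbers $a,b,c$ are pairwise relatively prime. -}

{-# OPTIONS --safe #-}
module Submission where

-- With x = a, y = b², z = c² the equation becomes
--   x² + y² + z² + k y z + 2 x y + 2 x z = (7 + k) x y z,
-- which is a monic quadratic in each variable.  Replacing one variable by the other root
-- of its quadratic (Vieta jumping) gives again a positive solution, keeps every common
-- divisor of x, y, z, and makes x + y + z smaller unless x² ≤ y² + z² + k y z,
-- y ≤ x + z and z ≤ x + y.  In that reduced position, if x, y, z ≥ 2, the left side is at
-- most (4 + k) x y z, so there is no such solution; since a common divisor d ≥ 2 forces
-- x, y, z ≥ 2, descent shows gcd(x, y, z) = 1.  Finally the equation shows that a common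
-- divisor of two of x, y, z divides the square of the third, which upgrades gcd(x, y, z) = 1
-- to pairwise coprimality.

open import Data.Empty using (⊥; ⊥-elim)
open import Data.List.Base using (_∷_; [])
open import Data.Nat using (ℕ; zero; suc; _+_; _*_; _^_; _∸_; _≤_; _<_; _>_; z≤n; s≤s; z<s; _<?_; >-nonZero)
open import Data.Nat.Coprimality using (Coprime; coprime-divisor; gcd≡1⇒coprime)
open import Data.Nat.Divisibility
open import Data.Nat.GCD using (gcd; gcd[m,n]∣m; gcd[m,n]∣n)
open import Data.Nat.Induction using (<-wellFounded)
open import Data.Nat.Properties
open import Data.Nat.Tactic.RingSolver using (solve)
open import Data.Product using (_×_; _,_; ∃-syntax)
open import Data.Sum using (inj₁; inj₂)
open import Function.Bundles using (_⇔_; mk⇔; Equivalence)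
open import Induction.WellFounded using (Acc; acc)
open import Relation.Nullary using (¬_; yes; no; contradiction)
open import Relation.Binary.PropositionalEquality using (_≡_; refl; sym; trans; cong; subst; module ≡-Reasoning)

vieta-other-root : ∀ {u u′ A B T} → u + A + u′ ≡ T → u * u′ ≡ B → u′ * (u′ + A) + B ≡ u′ * T
vieta-other-root {u} {u′} {A} {B} {T} sum product = begin
  u′ * (u′ + A) + B      ≡⟨ cong (u′ * (u′ + A) +_) product ⟨
  u′ * (u′ + A) + u * u′ ≡⟨ solve (u ∷ u′ ∷ A ∷ []) ⟩
  u′ * (u + A + u′)      ≡⟨ cong (u′ *_) sum ⟩
  u′ * T                 ∎
  where open ≡-Reasoning

vieta-jump : ∀ {u A B T} → 0 < u → u * (u + A) + B ≡ u * T →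
             ∃[ u′ ] u + A + u′ ≡ T × u * u′ ≡ B
vieta-jump {u} {A} {B} {T} u>0 root = u′ , sum , product
  where
  instance _ = >-nonZero u>0
  u′ = T ∸ (u + A)
  sum : u + A + u′ ≡ T
  sum = m+[n∸m]≡n (*-cancelˡ-≤ u (subst (u * (u + A) ≤_) root (m≤m+n _ B)))
  product : u * u′ ≡ B
  product = +-cancelˡ-≡ (u * (u + A)) _ _ (begin
    u * (u + A) + u * u′  ≡⟨ *-distribˡ-+ u (u + A) u′ ⟨
    u * (u + A + u′)      ≡⟨ cong (u *_) sum ⟩
    u * T                 ≡⟨ root ⟨
    u * (u + A) + B       ∎)
    where open ≡-Reasoning

vieta-descent : ∀ {A B T d} (P : ℕ → Set) → (∀ t → P t ⇔ t * (t + A) + B ≡ t * T) →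
                ∀ {u} → 0 < u → P u → 0 < B → B < u * u → d ∣ u + A → d ∣ T →
                ∃[ u′ ] 0 < u′ × u′ < u × P u′ × d ∣ u′
vieta-descent {d = d} P P⇔root {u} u>0 Pu B>0 B<u² d∣u+A d∣T
  with u′ , sum , product ← vieta-jump u>0 (Equivalence.to (P⇔root u) Pu)
  = u′ , u′>0 , u′<u , Equivalence.from (P⇔root u′) (vieta-other-root {u} sum product) , d∣u′
  where
  u′>0 : 0 < u′
  u′>0 = n≢0⇒n>0 λ u′≡0 → n>0⇒n≢0 B>0 (trans (sym product) (trans (cong (u *_) u′≡0) (*-zeroʳ u)))
  u′<u : u′ < u
  u′<u = *-cancelˡ-< u u′ u (subst (_< u * u) (sym product) B<u²)
  d∣u′ : d ∣ u′
  d∣u′ = ∣m+n∣m⇒∣n (subst (d ∣_) (sym sum) d∣T) d∣u+A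

form : ℕ → ℕ → ℕ → ℕ → ℕ
form k x y z = x * x + y * y + z * z + k * y * z + 2 * x * y + 2 * x * z

record Solution (k x y z : ℕ) : Set where
  constructor solution
  field equation : form k x y z ≡ (7 + k) * x * y * z

solution⇔ : ∀ {k x y z L R} → form k x y z ≡ L → (7 + k) * x * y * z ≡ R → Solution k x y z ⇔ L ≡ R
solution⇔ form≡L rhs≡R = mk⇔ (λ (solution eq) → trans (sym form≡L) (trans eq rhs≡R))
                             (λ L≡R → solution (trans form≡L (trans L≡R (sym rhs≡R))))

form-swap : ∀ k x y z → form k x y z ≡ form k x z y
form-swap k x y z = expanded
  where
  expanded : x * x + y * y + z * z + k * y * z + 2 * x * y + 2 * x * z
        ≡ x * x + z * z + y * y + k * z * y + 2 * x * z + 2 * x * y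
  expanded = solve (k ∷ x ∷ y ∷ z ∷ [])

solution-swap : ∀ {k x y z} → Solution k x y z → Solution k x z y
solution-swap {k} {x} {y} {z} (solution eq) = solution (begin
  form k x z y          ≡⟨ form-swap k x z y ⟩
  form k x y z          ≡⟨ eq ⟩
  (7 + k) * x * y * z   ≡⟨ solve (k ∷ x ∷ y ∷ z ∷ []) ⟩
  (7 + k) * x * z * y   ∎)
  where open ≡-Reasoning

jump-x : ∀ {k d x y z} → 0 < x → 0 < y → Solution k x y z →
         y * y + z * z + k * y * z < x * x → d ∣ x → d ∣ y → d ∣ z →
         ∃[ x′ ] 0 < x′ × x′ < x × Solution k x′ y z × d ∣ x′
jump-x {k} {x = x} {y} {z} x>0 y>0 sol B<x² d∣x d∣y d∣z =
  vieta-descent (λ t → Solution k t y z) (λ t → solution⇔ (quadratic t) (linear t))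
    x>0 sol B>0 B<x² (∣m∣n⇒∣m+n d∣x (∣n⇒∣m*n 2 (∣m∣n⇒∣m+n d∣y d∣z))) (∣n⇒∣m*n ((7 + k) * y) d∣z)
  where
  quadratic : ∀ t → t * t + y * y + z * z + k * y * z + 2 * t * y + 2 * t * z
                  ≡ t * (t + 2 * (y + z)) + (y * y + z * z + k * y * z)
  quadratic t = solve (k ∷ t ∷ y ∷ z ∷ [])
  linear : ∀ t → (7 + k) * t * y * z ≡ t * ((7 + k) * y * z)
  linear t = solve (k ∷ t ∷ y ∷ z ∷ [])
  B>0 : 0 < y * y + z * z + k * y * z
  B>0 = <-≤-trans (*-mono-< y>0 y>0) (≤-trans (m≤m+n _ _) (m≤m+n _ _))

jump-y : ∀ {k d x y z} → 0 < x → 0 < y → Solution k x y z →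
         x + z < y → d ∣ x → d ∣ y → d ∣ z →
         ∃[ y′ ] 0 < y′ × y′ < y × Solution k x y′ z × d ∣ y′
jump-y {k} {x = x} {y} {z} x>0 y>0 sol x+z<y d∣x d∣y d∣z =
  vieta-descent (λ t → Solution k x t z) (λ t → solution⇔ (quadratic t) (linear t))
    y>0 sol B>0 (*-mono-< x+z<y x+z<y)
    (∣m∣n⇒∣m+n d∣y (∣m∣n⇒∣m+n (∣n⇒∣m*n k d∣z) (∣n⇒∣m*n 2 d∣x))) (∣n⇒∣m*n ((7 + k) * x) d∣z)
  where
  quadratic : ∀ t → x * x + t * t + z * z + k * t * z + 2 * x * t + 2 * x * z
                  ≡ t * (t + (k * z + 2 * x)) + (x + z) * (x + z)
  quadratic t = solve (k ∷ x ∷ t ∷ z ∷ [])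
  linear : ∀ t → (7 + k) * x * t * z ≡ t * ((7 + k) * x * z)
  linear t = solve (k ∷ x ∷ t ∷ z ∷ [])
  B>0 : 0 < (x + z) * (x + z)
  B>0 = *-mono-< (<-≤-trans x>0 (m≤m+n x z)) (<-≤-trans x>0 (m≤m+n x z))

jump-z : ∀ {k d x y z} → 0 < x → 0 < z → Solution k x y z →
         x + y < z → d ∣ x → d ∣ y → d ∣ z →
         ∃[ z′ ] 0 < z′ × z′ < z × Solution k x y z′ × d ∣ z′
jump-z x>0 z>0 sol x+y<z d∣x d∣y d∣z
  with z′ , z′>0 , z′<z , sol′ , d∣z′ ← jump-y x>0 z>0 (solution-swap sol) x+y<z d∣x d∣z d∣y
  = z′ , z′>0 , z′<z , solution-swap sol′ , d∣z′

form-bound-x-largest : ∀ k {x y z} → 2 ≤ x → 2 ≤ y → 2 ≤ z → y ≤ x → z ≤ x →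
                       x * x ≤ y * y + z * z + k * y * z → form k x y z ≤ (4 + k) * (x * y * z)
form-bound-x-largest k {x} {y} {z} 2≤x 2≤y 2≤z y≤x z≤x x²≤B = begin
  x * x + y * y + z * z + k * y * z + 2 * x * y + 2 * x * z
    ≡⟨ solve (k ∷ x ∷ y ∷ z ∷ []) ⟩
  x * x + (2 * (x * y) + 2 * (x * z) + (y * y + z * z + k * y * z))
    ≤⟨ +-monoˡ-≤ _ x²≤B ⟩
  y * y + z * z + k * y * z + (2 * (x * y) + 2 * (x * z) + (y * y + z * z + k * y * z))
    ≡⟨ solve (k ∷ x ∷ y ∷ z ∷ []) ⟩
  2 * (y * y + x * y) + 2 * (z * z + x * z) + 2 * (k * (y * z))
    ≤⟨ +-mono-≤ (+-mono-≤ (*-monoʳ-≤ 2 (+-monoˡ-≤ _ (*-monoˡ-≤ y y≤x)))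
                          (*-monoʳ-≤ 2 (+-monoˡ-≤ _ (*-monoˡ-≤ z z≤x))))
                (*-monoˡ-≤ _ 2≤x) ⟩
  2 * (x * y + x * y) + 2 * (x * z + x * z) + x * (k * (y * z))
    ≡⟨ solve (k ∷ x ∷ y ∷ z ∷ []) ⟩
  2 * (2 * (x * y)) + 2 * (2 * (x * z)) + k * (x * y * z)
    ≤⟨ +-monoˡ-≤ _ (+-mono-≤ (*-monoˡ-≤ _ 2≤z) (*-monoˡ-≤ _ 2≤y)) ⟩
  z * (2 * (x * y)) + y * (2 * (x * z)) + k * (x * y * z)
    ≡⟨ solve (k ∷ x ∷ y ∷ z ∷ []) ⟩
  (4 + k) * (x * y * z) ∎
  where open ≤-Reasoning

form-bound-y-largest : ∀ k {x y z} → 2 ≤ x → 2 ≤ y → 2 ≤ z → x ≤ y → z ≤ y →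
                       y ≤ x + z → form k x y z ≤ (4 + k) * (x * y * z)
form-bound-y-largest k {x} {y} {z} 2≤x 2≤y 2≤z x≤y z≤y y≤x+z = begin
  x * x + y * y + z * z + k * y * z + 2 * x * y + 2 * x * z
    ≡⟨ solve (k ∷ x ∷ y ∷ z ∷ []) ⟩
  x * x + y * y + z * z + (2 * (x * y) + 2 * (x * z) + k * (y * z))
    ≤⟨ +-monoˡ-≤ _ (+-mono-≤ (+-mono-≤ (*-monoʳ-≤ x x≤y) (*-monoʳ-≤ y y≤x+z)) (*-monoˡ-≤ z z≤y)) ⟩
  x * y + y * (x + z) + y * z + (2 * (x * y) + 2 * (x * z) + k * (y * z))
    ≡⟨ solve (k ∷ x ∷ y ∷ z ∷ []) ⟩
  2 * (2 * (x * y)) + 2 * (y * z) + 2 * (x * z) + k * (y * z)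
    ≤⟨ +-mono-≤ (+-mono-≤ (+-mono-≤ (*-monoˡ-≤ _ 2≤z) (*-monoˡ-≤ _ 2≤x)) (*-monoˡ-≤ _ 2≤y))
                (≤-trans (m≤m+n _ _) (*-monoˡ-≤ _ 2≤x)) ⟩
  z * (2 * (x * y)) + x * (y * z) + y * (x * z) + x * (k * (y * z))
    ≡⟨ solve (k ∷ x ∷ y ∷ z ∷ []) ⟩
  (4 + k) * (x * y * z) ∎
  where open ≤-Reasoning

reduced-not-solution : ∀ {k x y z} → 2 ≤ x → 2 ≤ y → 2 ≤ z →
                       x * x ≤ y * y + z * z + k * y * z → y ≤ x + z → z ≤ x + y →
                       ¬ Solution k x y z
reduced-not-solution {k} {x} {y} {z} 2≤x 2≤y 2≤z x²≤B y≤x+z z≤x+y (solution eq) =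
  <-irrefl eq (≤-<-trans bound slack)
  where
  slack : (4 + k) * (x * y * z) < (7 + k) * x * y * z
  slack = begin-strict
    (4 + k) * (x * y * z)                   <⟨ m<n+m _ (*-monoʳ-< 3 xyz>0) ⟩
    3 * (x * y * z) + (4 + k) * (x * y * z) ≡⟨ solve (k ∷ x ∷ y ∷ z ∷ []) ⟩
    (7 + k) * x * y * z                     ∎
    where
    open ≤-Reasoning
    xyz>0 : 0 < x * y * z
    xyz>0 = *-mono-< (*-mono-< (<-≤-trans z<s 2≤x) (<-≤-trans z<s 2≤y)) (<-≤-trans z<s 2≤z)
  bound : form k x y z ≤ (4 + k) * (x * y * z)
  bound with ≤-total z y
  ... | inj₁ z≤y with ≤-total y x
  ...   | inj₁ y≤x = form-bound-x-largest k 2≤x 2≤y 2≤z y≤x (≤-trans z≤y y≤x) x²≤B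
  ...   | inj₂ x≤y = form-bound-y-largest k 2≤x 2≤y 2≤z x≤y z≤y y≤x+z
  bound | inj₂ y≤z with ≤-total z x
  ...   | inj₁ z≤x = form-bound-x-largest k 2≤x 2≤y 2≤z (≤-trans y≤z z≤x) z≤x x²≤B
  ...   | inj₂ x≤z = begin
    form k x y z          ≡⟨ form-swap k x y z ⟩
    form k x z y          ≤⟨ form-bound-y-largest k 2≤x 2≤z 2≤y x≤z y≤z z≤x+y ⟩
    (4 + k) * (x * z * y) ≡⟨ solve (k ∷ x ∷ y ∷ z ∷ []) ⟩
    (4 + k) * (x * y * z) ∎
    where open ≤-Reasoning

no-common-factor : ∀ {k d x y z} → Acc _<_ (x + y + z) → 2 ≤ d → 0 < x → 0 < y → 0 < z →
                   Solution k x y z → d ∣ x → d ∣ y → d ∣ z → ⊥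
no-common-factor {k} {d} {x} {y} {z} (acc smaller) 2≤d x>0 y>0 z>0 sol d∣x d∣y d∣z
  with y * y + z * z + k * y * z <? x * x | x + z <? y | x + y <? z
... | yes B<x² | _ | _
  with x′ , x′>0 , x′<x , sol′ , d∣x′ ← jump-x x>0 y>0 sol B<x² d∣x d∣y d∣z
  = no-common-factor (smaller (+-monoˡ-< z (+-monoˡ-< y x′<x))) 2≤d x′>0 y>0 z>0 sol′ d∣x′ d∣y d∣z
... | no _ | yes x+z<y | _
  with y′ , y′>0 , y′<y , sol′ , d∣y′ ← jump-y x>0 y>0 sol x+z<y d∣x d∣y d∣z
  = no-common-factor (smaller (+-monoˡ-< z (+-monoʳ-< x y′<y))) 2≤d x>0 y′>0 z>0 sol′ d∣x d∣y′ d∣z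
... | no _ | no _ | yes x+y<z
  with z′ , z′>0 , z′<z , sol′ , d∣z′ ← jump-z x>0 z>0 sol x+y<z d∣x d∣y d∣z
  = no-common-factor (smaller (+-monoʳ-< (x + y) z′<z)) 2≤d x>0 y>0 z′>0 sol′ d∣x d∣y d∣z′
... | no x²≮B | no x+z≮y | no x+y≮z =
  reduced-not-solution (≥d x>0 d∣x) (≥d y>0 d∣y) (≥d z>0 d∣z) (≮⇒≥ x²≮B) (≮⇒≥ x+z≮y) (≮⇒≥ x+y≮z) sol
  where
  ≥d : ∀ {n} → 0 < n → d ∣ n → 2 ≤ n
  ≥d n>0 d∣n = ≤-trans 2≤d (∣⇒≤ {{>-nonZero n>0}} d∣n)

Coprime₃ : ℕ → ℕ → ℕ → Set
Coprime₃ x y z = ∀ {d} → d ∣ x → d ∣ y → d ∣ z → d ≡ 1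

solution-coprime₃ : ∀ {k x y z} → 0 < x → 0 < y → 0 < z → Solution k x y z → Coprime₃ x y z
solution-coprime₃ x>0 _ _ _ {zero} 0∣x _ _ = contradiction (0∣⇒≡0 0∣x) (n>0⇒n≢0 x>0)
solution-coprime₃ _ _ _ _ {suc zero} _ _ _ = refl
solution-coprime₃ x>0 y>0 z>0 sol {suc (suc d)} d∣x d∣y d∣z =
  ⊥-elim (no-common-factor (<-wellFounded _) (s≤s (s≤s z≤n)) x>0 y>0 z>0 sol d∣x d∣y d∣z)

coprime-of-∣-square : ∀ {x y z} → Coprime₃ x y z → (∀ {i} → i ∣ x → i ∣ y → i ∣ z * z) →
                      Coprime x y
coprime-of-∣-square {z = z} coprime₃ i∣z² {i} (i∣x , i∣y) = coprime₃ i∣x i∣y i∣z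
  where
  g∣i = gcd[m,n]∣m i z
  i∣z : i ∣ z
  i∣z = coprime-divisor (gcd≡1⇒coprime (coprime₃ (∣-trans g∣i i∣x) (∣-trans g∣i i∣y) (gcd[m,n]∣n i z)))
                        (i∣z² i∣x i∣y)

solution-∣z² : ∀ {k x y z i} → Solution k x y z → i ∣ x → i ∣ y → i ∣ z * z
solution-∣z² {k} {x} {y} {z} {i} (solution eq) i∣x i∣y =
  ∣m+n∣m⇒∣n (subst (i ∣_) (trans (sym eq) split) (∣m⇒∣m*n z (∣m⇒∣m*n y (∣n⇒∣m*n (7 + k) i∣x))))
            (∣m∣n⇒∣m+n (∣m⇒∣m*n _ i∣x) (∣m⇒∣m*n _ i∣y))
  where
  split : x * x + y * y + z * z + k * y * z + 2 * x * y + 2 * x * z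
        ≡ x * (x + 2 * y + 2 * z) + y * (y + k * z) + z * z
  split = solve (k ∷ x ∷ y ∷ z ∷ [])

solution-∣x² : ∀ {k x y z i} → Solution k x y z → i ∣ y → i ∣ z → i ∣ x * x
solution-∣x² {k} {x} {y} {z} {i} (solution eq) i∣y i∣z =
  ∣m+n∣m⇒∣n (subst (i ∣_) (trans (sym eq) split) (∣n⇒∣m*n ((7 + k) * x * y) i∣z))
            (∣m∣n⇒∣m+n (∣m⇒∣m*n _ i∣y) (∣m⇒∣m*n _ i∣z))
  where
  split : x * x + y * y + z * z + k * y * z + 2 * x * y + 2 * x * z
        ≡ y * (y + k * z + 2 * x) + z * (z + 2 * x) + x * x
  split = solve (k ∷ x ∷ y ∷ z ∷ [])

solution-pairwise-coprime : ∀ {k x y z} → 0 < x → 0 < y → 0 < z → Solution k x y z →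
                            Coprime x y × Coprime y z × Coprime x z
solution-pairwise-coprime {x = x} {y} {z} x>0 y>0 z>0 sol =
  coprime-of-∣-square coprime₃ (solution-∣z² sol) ,
  coprime-of-∣-square (λ d∣y d∣z d∣x → coprime₃ d∣x d∣y d∣z) (solution-∣x² sol) ,
  coprime-of-∣-square (λ d∣x d∣z d∣y → coprime₃ d∣x d∣y d∣z) (solution-∣z² (solution-swap sol))
  where
  coprime₃ : Coprime₃ x y z
  coprime₃ = solution-coprime₃ x>0 y>0 z>0 sol

coprime-∣ : ∀ {m n m′ n′} → m′ ∣ m → n′ ∣ n → Coprime m n → Coprime m′ n′
coprime-∣ m′∣m n′∣n coprime (d∣m′ , d∣n′) = coprime (∣-trans d∣m′ m′∣m , ∣-trans d∣n′ n′∣n)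

corollary3p3 : (k a b c : ℕ) → a > 0 → b > 0 → c > 0 →
    a ^ 2 + b ^ 4 + c ^ 4 + k * b ^ 2 * c ^ 2 + 2 * a * b ^ 2 + 2 * a * c ^ 2
      ≡ (7 + k) * a * b ^ 2 * c ^ 2 →
    Coprime a b × Coprime b c × Coprime a c
corollary3p3 k a b c a>0 b>0 c>0 eq =
  let a⊥b² , b²⊥c² , a⊥c² = solution-pairwise-coprime a>0 (square>0 b>0) (square>0 c>0) sol
  in coprime-∣ ∣-refl b∣b² a⊥b² , coprime-∣ b∣b² c∣c² b²⊥c² , coprime-∣ ∣-refl c∣c² a⊥c²
  where
  square>0 : ∀ {n} → n > 0 → n ^ 2 > 0
  square>0 {n} n>0 = m^n>0 n {{>-nonZero n>0}} 2
  b∣b² : b ∣ b ^ 2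
  b∣b² = m∣m*n (b ^ 1)
  c∣c² : c ∣ c ^ 2
  c∣c² = m∣m*n (c ^ 1)
  squares : form k a (b ^ 2) (c ^ 2)
          ≡ a ^ 2 + b ^ 4 + c ^ 4 + k * b ^ 2 * c ^ 2 + 2 * a * b ^ 2 + 2 * a * c ^ 2
  squares rewrite *-identityʳ a | ^-distribˡ-+-* b 2 2 | ^-distribˡ-+-* c 2 2 = refl
  sol : Solution k a (b ^ 2) (c ^ 2)
  sol = solution (trans squares eq)
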